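{- Let $(X_1,\prec_1)$ and $(X_2,\prec_2)$ be finite posets and let $(X_1\dot\cup X_2,A,\prec)$ be an alignment of them satisfying condition (R). Then the relation $R=\{(x,y)\in X_1\times X_2:\{x,y\}\in A\}$ satisfies (M) and (P), and the alignment corresponds to $R$ (its columns are the pairs in $R$ and the singletons of unmatched elements).
   Context: For posets $(X_a,\prec_a)$, $a=1,2$, with disjoint union $X$ and a graph $(X,A)$ with set of connected components (columns) $\mathcal{C}(X,A)$, an alignment is a triple $(X,A,\prec)$ with $\prec$ a strict partial order on $\mathcal{C}(X,A)$ such that: (A1) every column is a complete subgraph; (A2) no column contains two distinct elements of the same $X_a$; (A3) if $u\in P$, $v\in Q$ lie in the same $X_a$ and $u\prec_a v$, then $P\prec Q$; (A4) if $P\prec Q$, $u\in P$, $v\in Q$ lie in the same $X_a$, then $u\prec_a v$ or $u,v$ are incomparable w.r.t. $\prec_a$. Condition (R): if $P\prec Q$, $u\in P$, $v\in Q$ and $u,v$ lie in the same $X_a$, then $u\prec_a v$. For $R\subseteq X_1\times X_2$: (M) means $(x,y),(x,z)\in R$ implies $y=z$, and $(x,z),(y,z)\in R$ implies $x=y$; (P) means that whenever $(x_1,y_1),(x_2,y_2)\in R$, $x_1\prec_1 x_2$ if and only if $y_1\prec_2 y_2$. -}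

module Defs where

open import Level using (0ℓ)
open import Data.Nat using (ℕ)
open import Data.Fin using (Fin)
open import Data.Sum using (_⊎_; inj₁; inj₂)
open import Data.Product using (_×_; ∃₂)
open import Relation.Nullary using (¬_)
open import Relation.Binary.Core using (Rel)
open import Relation.Binary.Structures using (IsStrictPartialOrder)
open import Relation.Binary.PropositionalEquality using (_≡_)
open import Relation.Binary.Construct.Closure.ReflexiveTransitive using (Star)
open import Function.Bundles using (_⇔_)

record FinPoset : Set₁ where
  field
    size  : ℕ
    _≺_   : Rel (Fin size) 0ℓ
    isSPO : IsStrictPartialOrder _≡_ _≺_

Carrier : FinPoset → FinPoset → Set
Carrier P₁ P₂ = Fin (FinPoset.size P₁) ⊎ Fin (FinPoset.size P₂)

-- Same column = same connected component of the graph (X, A):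
-- reflexive-transitive closure of the (symmetric) edge relation.
SameCol : {X : Set} → Rel X 0ℓ → Rel X 0ℓ
SameCol A = Star A

SameSide≺ : (P₁ P₂ : FinPoset) → Rel (Carrier P₁ P₂) 0ℓ
SameSide≺ P₁ P₂ u v =
  (∃₂ λ x y → u ≡ inj₁ x × v ≡ inj₁ y × FinPoset._≺_ P₁ x y)
  ⊎ (∃₂ λ x y → u ≡ inj₂ x × v ≡ inj₂ y × FinPoset._≺_ P₂ x y)

SameSide : (P₁ P₂ : FinPoset) → Rel (Carrier P₁ P₂) 0ℓ
SameSide P₁ P₂ u v =
  (∃₂ λ x y → u ≡ inj₁ x × v ≡ inj₁ y) ⊎ (∃₂ λ x y → u ≡ inj₂ x × v ≡ inj₂ y)

-- The strict partial order on the set of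
-- columns C(X,A) is represented by a relation _⊏_ on vertices which respects
-- the "same column" relation (so it descends to columns), and whose induced
-- relation on columns is irreflexive and transitive.
record Alignment (P₁ P₂ : FinPoset) : Set₁ where
  X = Carrier P₁ P₂
  field
    A      : Rel X 0ℓ
    A-sym  : ∀ {u v} → A u v → A v u
    A-irr  : ∀ {u} → ¬ A u u
    _⊏_    : Rel X 0ℓ
    ⊏-resp : ∀ {u u′ v v′} → SameCol A u u′ → SameCol A v v′ → u ⊏ v → u′ ⊏ v′
    ⊏-irr  : ∀ {u} → ¬ (u ⊏ u)
    ⊏-trans : ∀ {u v w} → u ⊏ v → v ⊏ w → u ⊏ w
    A1 : ∀ {u v} → SameCol A u v → ¬ (u ≡ v) → A u v
    A2 : ∀ {u v} → SameCol A u v → SameSide P₁ P₂ u v → u ≡ v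
    A3 : ∀ {u v} → SameSide≺ P₁ P₂ u v → u ⊏ v
    A4 : ∀ {u v} → u ⊏ v → SameSide P₁ P₂ u v →
         SameSide≺ P₁ P₂ u v ⊎ (¬ SameSide≺ P₁ P₂ u v × ¬ SameSide≺ P₁ P₂ v u)

CondR : {P₁ P₂ : FinPoset} → Alignment P₁ P₂ → Set
CondR {P₁} {P₂} Al = ∀ {u v} → u ⊏ v → SameSide P₁ P₂ u v → SameSide≺ P₁ P₂ u v
  where open Alignment Al

RelOf : {P₁ P₂ : FinPoset} → Alignment P₁ P₂ →
        Fin (FinPoset.size P₁) → Fin (FinPoset.size P₂) → Set
RelOf Al x y = Alignment.A Al (inj₁ x) (inj₂ y)

CondM : {P₁ P₂ : FinPoset} →
        (Fin (FinPoset.size P₁) → Fin (FinPoset.size P₂) → Set) → Set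
CondM R = (∀ {x y z} → R x y → R x z → y ≡ z) × (∀ {x y z} → R x z → R y z → x ≡ y)

CondP : (P₁ P₂ : FinPoset) →
        (Fin (FinPoset.size P₁) → Fin (FinPoset.size P₂) → Set) → Set
CondP P₁ P₂ R = ∀ {x₁ y₁ x₂ y₂} → R x₁ y₁ → R x₂ y₂ →
  (FinPoset._≺_ P₁ x₁ x₂ ⇔ FinPoset._≺_ P₂ y₁ y₂)

MatchedPair : {P₁ P₂ : FinPoset} →
              (Fin (FinPoset.size P₁) → Fin (FinPoset.size P₂) → Set) →
              Rel (Carrier P₁ P₂) 0ℓ
MatchedPair R u v =
  (∃₂ λ x y → u ≡ inj₁ x × v ≡ inj₂ y × R x y)
  ⊎ (∃₂ λ x y → u ≡ inj₂ y × v ≡ inj₁ x × R x y)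

CorrespondsTo : {P₁ P₂ : FinPoset} → (Al : Alignment P₁ P₂) →
                (Fin (FinPoset.size P₁) → Fin (FinPoset.size P₂) → Set) → Set
CorrespondsTo {P₁} {P₂} Al R =
  ∀ (u v : Carrier P₁ P₂) → SameCol (Alignment.A Al) u v ⇔ (u ≡ v ⊎ MatchedPair {P₁} {P₂} R u v)

-- Condition (R) makes the column order transport the order of one side to the
-- other: if (x₁,y₁), (x₂,y₂) ∈ R and x₁ ≺₁ x₂, then (A3) puts the column of
-- x₁, y₁ below that of x₂, y₂, and (R) turns this into y₁ ≺₂ y₂; symmetrically
-- backwards.  (M) and the shape of the columns need only (A1) and (A2): a column
-- holds at most one element of each side, and any two of its elements are
-- joined by an edge.
module Submission where

open import Defs
open import Data.Product using (_×_; _,_)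
open import Data.Sum using (_⊎_; inj₁; inj₂)
open import Data.Fin using (Fin) renaming (_≟_ to _≟F_)
open import Data.Sum.Properties using (≡-dec; inj₁-injective; inj₂-injective)
open import Data.Empty using (⊥-elim)
open import Relation.Nullary using (yes; no)
open import Relation.Binary.PropositionalEquality using (_≡_; refl)
open import Relation.Binary.Construct.Closure.ReflexiveTransitive using (ε; _◅_)
open import Function.Bundles using (mk⇔)

module _ {P₁ P₂ : FinPoset} where

  open FinPoset P₁ using () renaming (size to n₁; _≺_ to _≺₁_)
  open FinPoset P₂ using () renaming (size to n₂; _≺_ to _≺₂_)

  sameSide₁ : (x y : Fin n₁) → SameSide P₁ P₂ (inj₁ x) (inj₁ y)
  sameSide₁ x y = inj₁ (x , y , refl , refl)

  sameSide₂ : (x y : Fin n₂) → SameSide P₁ P₂ (inj₂ x) (inj₂ y)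
  sameSide₂ x y = inj₂ (x , y , refl , refl)

  SameSide≺-inj₁⁻ : ∀ {x y} → SameSide≺ P₁ P₂ (inj₁ x) (inj₁ y) → x ≺₁ y
  SameSide≺-inj₁⁻ (inj₁ (_ , _ , refl , refl , x≺y)) = x≺y
  SameSide≺-inj₁⁻ (inj₂ (_ , _ , () , _))

  SameSide≺-inj₂⁻ : ∀ {x y} → SameSide≺ P₁ P₂ (inj₂ x) (inj₂ y) → x ≺₂ y
  SameSide≺-inj₂⁻ (inj₁ (_ , _ , () , _))
  SameSide≺-inj₂⁻ (inj₂ (_ , _ , refl , refl , x≺y)) = x≺y

  module _ (Al : Alignment P₁ P₂) where

    open Alignment Al

    edge⇒sameCol : ∀ {u v} → A u v → SameCol A u v
    edge⇒sameCol a = a ◅ ε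

    RelOf-functional : ∀ {x y z} → RelOf Al x y → RelOf Al x z → y ≡ z
    RelOf-functional {y = y} {z} r s =
      inj₂-injective (A2 (A-sym r ◅ s ◅ ε) (sameSide₂ y z))

    RelOf-injective : ∀ {x y z} → RelOf Al x z → RelOf Al y z → x ≡ y
    RelOf-injective {x} {y} r s =
      inj₁-injective (A2 (r ◅ A-sym s ◅ ε) (sameSide₁ x y))

    RelOf-condM : CondM {P₁} {P₂} (RelOf Al)
    RelOf-condM = RelOf-functional , RelOf-injective

    sameCol⇒≡⊎matched : ∀ u v → SameCol A u v → u ≡ v ⊎ MatchedPair {P₁} {P₂} (RelOf Al) u v
    sameCol⇒≡⊎matched u v uv with ≡-dec _≟F_ _≟F_ u v
    ... | yes u≡v = inj₁ u≡v
    sameCol⇒≡⊎matched (inj₁ x) (inj₁ y) uv | no x≢y = ⊥-elim (x≢y (A2 uv (sameSide₁ x y)))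
    sameCol⇒≡⊎matched (inj₂ x) (inj₂ y) uv | no x≢y = ⊥-elim (x≢y (A2 uv (sameSide₂ x y)))
    sameCol⇒≡⊎matched (inj₁ x) (inj₂ y) uv | no x≢y =
      inj₂ (inj₁ (x , y , refl , refl , A1 uv x≢y))
    sameCol⇒≡⊎matched (inj₂ y) (inj₁ x) uv | no y≢x =
      inj₂ (inj₂ (x , y , refl , refl , A-sym (A1 uv y≢x)))

    ≡⊎matched⇒sameCol : ∀ u v → u ≡ v ⊎ MatchedPair {P₁} {P₂} (RelOf Al) u v → SameCol A u v
    ≡⊎matched⇒sameCol u .u (inj₁ refl)                          = ε
    ≡⊎matched⇒sameCol _ _  (inj₂ (inj₁ (_ , _ , refl , refl , r))) = edge⇒sameCol r
    ≡⊎matched⇒sameCol _ _  (inj₂ (inj₂ (_ , _ , refl , refl , r))) = edge⇒sameCol (A-sym r)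

    correspondsTo-RelOf : CorrespondsTo Al (RelOf Al)
    correspondsTo-RelOf u v = mk⇔ (sameCol⇒≡⊎matched u v) (≡⊎matched⇒sameCol u v)

    module _ (condR : CondR Al) where

      SameSide≺-transport : ∀ {u v u′ v′} → SameCol A u u′ → SameCol A v v′ →
                            SameSide≺ P₁ P₂ u v → SameSide P₁ P₂ u′ v′ →
                            SameSide≺ P₁ P₂ u′ v′
      SameSide≺-transport uu′ vv′ u≺v = condR (⊏-resp uu′ vv′ (A3 u≺v))

      RelOf-monotone : ∀ {x₁ y₁ x₂ y₂} → RelOf Al x₁ y₁ → RelOf Al x₂ y₂ →
                       x₁ ≺₁ x₂ → y₁ ≺₂ y₂
      RelOf-monotone {x₁} {y₁} {x₂} {y₂} r s x₁≺x₂ = SameSide≺-inj₂⁻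
        (SameSide≺-transport (edge⇒sameCol r) (edge⇒sameCol s)
          (inj₁ (x₁ , x₂ , refl , refl , x₁≺x₂)) (sameSide₂ y₁ y₂))

      RelOf-reflects : ∀ {x₁ y₁ x₂ y₂} → RelOf Al x₁ y₁ → RelOf Al x₂ y₂ →
                       y₁ ≺₂ y₂ → x₁ ≺₁ x₂
      RelOf-reflects {x₁} {y₁} {x₂} {y₂} r s y₁≺y₂ = SameSide≺-inj₁⁻
        (SameSide≺-transport (edge⇒sameCol (A-sym r)) (edge⇒sameCol (A-sym s))
          (inj₂ (y₁ , y₂ , refl , refl , y₁≺y₂)) (sameSide₁ x₁ x₂))

      RelOf-condP : CondP P₁ P₂ (RelOf Al)
      RelOf-condP r s = mk⇔ (RelOf-monotone r s) (RelOf-reflects r s)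

lemma6p3 : (P₁ P₂ : FinPoset) (Al : Alignment P₁ P₂) → CondR Al →
    CondM {P₁} {P₂} (RelOf Al) × CondP P₁ P₂ (RelOf Al) × CorrespondsTo Al (RelOf Al)
lemma6p3 P₁ P₂ Al condR = RelOf-condM Al , RelOf-condP Al condR , correspondsTo-RelOf Al
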